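{- For every integer $k\geq 2$ there exists a connected simple graph $G$ containing exactly $k$ cycles such that $$\frac{M_1(G)}{n}>\frac{M_2(G)}{m},$$ where $n$ and $m$ are the numbers of vertices and edges of $G$, $M_1(G)=\sum_{v} d_v^2$ and $M_2(G)=\sum_{uv\in E(G)} d_u d_v$, with $d_v$ the degree of vertex $v$.
   Context: $M_1$ and $M_2$ are the first and second Zagreb indices; in $M_2$ each edge is counted once. -}

module Defs where

open import Data.Nat using (ℕ; zero; suc; _+_; _*_; _<_)
open import Data.Bool using (Bool; true; false; T; if_then_else_; _∧_)
open import Data.Fin using (Fin; _<?_)
open import Data.List using (List; map; allFin)
open import Data.Nat.ListAction using (sum)
open import Data.Vec as Vec using (Vec)
open import Function.Bundles using (_⇔_)
open import Data.Product using (_×_; Σ)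
open import Data.Sum using (_⊎_)
open import Relation.Nullary.Decidable using (⌊_⌋)
open import Relation.Binary.PropositionalEquality using (_≡_)

record Graph : Set where
  field
    n     : ℕ
    adj   : Fin n → Fin n → Bool
    sym   : ∀ u v → adj u v ≡ adj v u
    irrefl : ∀ v → adj v v ≡ false
open Graph public

sumFin : (n : ℕ) → (Fin n → ℕ) → ℕ
sumFin n f = sum (map f (allFin n))

ind : Bool → ℕ
ind true  = 1
ind false = 0

Rel : ℕ → Set
Rel n = Fin n → Fin n → Bool

degR : {n : ℕ} → Rel n → Fin n → ℕ
degR {n} R v = sumFin n (λ w → ind (R v w))

data Reach {n : ℕ} (R : Rel n) : Fin n → Fin n → Set where
  here  : ∀ {v} → Reach R v v
  there : ∀ {u w v} → T (R u w) → Reach R w v → Reach R u v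

Connected : Graph → Set
Connected G = ∀ u v → Reach (adj G) u v

-- Edge sets are stored as n×n Boolean matrices (so equality is decidable/intensional-free).
EdgeSet : ℕ → Set
EdgeSet n = Vec (Vec Bool n) n

toRel : {n : ℕ} → EdgeSet n → Rel n
toRel C u v = Vec.lookup (Vec.lookup C u) v

IsCycle : (G : Graph) → EdgeSet (n G) → Set
IsCycle G C =
    (∀ u v → T (toRel C u v) → T (adj G u v))
  × (∀ u v → toRel C u v ≡ toRel C v u)
  × (∀ v → degR (toRel C) v ≡ 0 ⊎ degR (toRel C) v ≡ 2)
  × Σ (Fin (n G)) (λ u → Σ (Fin (n G)) (λ v → T (toRel C u v)))
  × (∀ u v → 0 < degR (toRel C) u → 0 < degR (toRel C) v → Reach (toRel C) u v)

HasExactlyCycles : Graph → ℕ → Set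
HasExactlyCycles G k =
  Σ (Vec (EdgeSet (n G)) k) (λ cs →
      (∀ i j → Vec.lookup cs i ≡ Vec.lookup cs j → i ≡ j)
    × (∀ C → IsCycle G C ⇔ (Σ (Fin k) (λ i → Vec.lookup cs i ≡ C))))

deg : (G : Graph) → Fin (n G) → ℕ
deg G = degR (adj G)

edgeCount : Graph → ℕ
edgeCount G = sumFin (n G) (λ u → sumFin (n G) (λ v → ind (⌊ u <? v ⌋ ∧ adj G u v)))

M1 : Graph → ℕ
M1 G = sumFin (n G) (λ v → deg G v * deg G v)

M2 : Graph → ℕ
M2 G = sumFin (n G) (λ u → sumFin (n G) (λ v →
         if ⌊ u <? v ⌋ ∧ adj G u v then deg G u * deg G v else 0))

-- G_k consists of a hub carrying k triangles hub – a i – b i,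
-- joined by a path hub – bridge – star to a star with 8k leaves, so that
--   n = 10k + 3,  m = 11k + 2,  M1 = 68k² + 36k + 6,  M2 = 72k² + 36k + 4,
-- and  M1·m − M2·n = 28k³ − 44k² − 10k > 0  for k ≥ 2.

module Submission where

open import Data.Bool using (Bool; true; false; T; if_then_else_; _∧_; _∨_)
open import Data.Bool.Properties using (∨-comm; ∨-identityʳ; T-∧)
open import Data.Empty using (⊥-elim)
open import Data.Fin using (Fin; zero; suc; _↑ˡ_; _↑ʳ_; _<?_; _≟_; splitAt; join)
open import Data.Fin.Properties using (splitAt-↑ˡ; splitAt-↑ʳ; join-splitAt)
open import Data.Integer as ℤ using (+<+)
import Data.Integer.Properties as ℤ
open import Data.List using (tabulate)
open import Data.List.Properties using (map-tabulate)
open import Data.Nat using (ℕ; zero; suc; _+_; _*_; _<_; _≤_; s≤s; z≤n; NonZero)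
open import Data.Nat.ListAction using () renaming (sum to listSum)
open import Data.Nat.Properties
  using (+-assoc; +-suc; m≤m+n; m+n≡0⇒n≡0; +-identityʳ; *-identityʳ; *-zeroʳ; *-comm; *-cancelˡ-≡; *-distribˡ-+; suc-injective; +-0-commutativeMonoid)
open import Data.Nat.Tactic.RingSolver using (solve-∀)
open import Data.Product using (Σ; ∃; _×_; _,_; proj₁; proj₂)
open import Function.Bundles using (Equivalence; mk⇔)
open import Data.Rational using (_/_) renaming (_<_ to _<ℚ_)
open import Data.Rational.Properties using (toℚᵘ-cancel-<; toℚᵘ-fromℚᵘ)
import Data.Rational.Unnormalised as ℚᵘ
import Data.Rational.Unnormalised.Properties as ℚᵘ
open import Data.Sum using (_⊎_; inj₁; inj₂)
import Data.Sum as Sum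
open import Data.Vec as Vec using (Vec)
open import Data.Vec.Properties using (tabulate∘lookup; tabulate-cong; lookup∘tabulate)
open import Function using (_∘_; id; case_of_)
open import Relation.Binary.PropositionalEquality
open import Relation.Nullary using (¬_; Dec; does; _because_; yes; no)
open import Relation.Nullary.Decidable using (⌊_⌋; dec-true)
open import Algebra.Properties.CommutativeMonoid.Sum +-0-commutativeMonoid
  using (sum; sum-syntax; sum-cong-≗; ∑-distrib-+)

open import Defs renaming (sym to adj-sym; irrefl to adj-irrefl)

sumFin≡sum : ∀ n (f : Fin n → ℕ) → sumFin n f ≡ sum f
sumFin≡sum n f = trans (cong listSum (map-tabulate id f)) (listSum-tabulate n f)
  where
  listSum-tabulate : ∀ n (f : Fin n → ℕ) → listSum (tabulate f) ≡ sum f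
  listSum-tabulate zero    f = refl
  listSum-tabulate (suc n) f = cong (f zero +_) (listSum-tabulate n (f ∘ suc))

sum-const : ∀ n c → ∑[ i < n ] c ≡ n * c
sum-const zero    c = refl
sum-const (suc n) c = cong (c +_) (sum-const n c)

sum-zero : ∀ n → ∑[ i < n ] 0 ≡ 0
sum-zero n = trans (sum-const n 0) (*-zeroʳ n)

sum-split : ∀ m n (f : Fin (m + n) → ℕ) →
            sum f ≡ ∑[ i < m ] f (i ↑ˡ n) + ∑[ j < n ] f (m ↑ʳ j)
sum-split zero    n f = refl
sum-split (suc m) n f =
  trans (cong (f zero +_) (sum-split m n (f ∘ suc))) (sym (+-assoc (f zero) _ _))

≟-sym : ∀ {k} (i j : Fin k) → does (i ≟ j) ≡ does (j ≟ i)
≟-sym i j with i ≟ j | j ≟ i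
... | yes _   | yes _   = refl
... | no  _   | no  _   = refl
... | yes i≡j | no  j≢i = ⊥-elim (j≢i (sym i≡j))
... | no  i≢j | yes j≡i = ⊥-elim (i≢j (sym j≡i))

≟-complete : ∀ {k} {i j : Fin k} → i ≡ j → T (does (i ≟ j))
≟-complete {i = i} {j} i≡j = subst T (sym (dec-true (i ≟ j) i≡j)) _

≟-sound : ∀ {k} {i j : Fin k} → T (does (i ≟ j)) → i ≡ j
≟-sound {i = i} {j} t with i ≟ j
... | yes i≡j = i≡j

sum-point : ∀ {k} (i : Fin k) (F : Bool → ℕ) → F false ≡ 0 →
            ∑[ j < k ] F (does (i ≟ j)) ≡ F true
sum-point {suc k} zero    F F0 =
  trans (cong (F true +_) (trans (sum-cong-≗ {k} (λ _ → F0)) (sum-zero k))) (+-identityʳ _)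
sum-point {suc k} (suc i) F F0 = trans (cong (_+ ∑[ j < k ] F (does (i ≟ j))) F0) (sum-point i F F0)

sum-point′ : ∀ {k} (i : Fin k) (F : Bool → ℕ) → F false ≡ 0 →
             ∑[ j < k ] F (does (j ≟ i)) ≡ F true
sum-point′ {k} i F F0 = trans (sum-cong-≗ {k} (λ j → cong F (≟-sym j i))) (sum-point i F F0)

upper : ∀ n → (Fin n → Fin n → ℕ) → ℕ
upper n h = ∑[ u < n ] ∑[ v < n ] (if does (u <? v) then h u v else 0)

-- Peeling off vertex 0: row 0 lies entirely above the diagonal, column 0 below.
upper-suc : ∀ n (h : Fin (suc n) → Fin (suc n) → ℕ) →
            upper (suc n) h ≡ ∑[ v < n ] h zero (suc v) + upper n (λ u v → h (suc u) (suc v))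
upper-suc n h = refl

double-upper : ∀ n (h : Fin n → Fin n → ℕ) → (∀ u v → h u v ≡ h v u) → (∀ u → h u u ≡ 0) →
               2 * upper n h ≡ ∑[ u < n ] ∑[ v < n ] h u v
double-upper zero    h h-sym h-diag = refl
double-upper (suc n) h h-sym h-diag = begin
    2 * upper (suc n) h        ≡⟨ cong (2 *_) (upper-suc n h) ⟩
    2 * (row + upper n h′)     ≡⟨ *-distribˡ-+ 2 row (upper n h′) ⟩
    2 * row + 2 * upper n h′   ≡⟨ cong (2 * row +_) (double-upper n h′ (λ u v → h-sym (suc u) (suc v)) (h-diag ∘ suc)) ⟩
    2 * row + rest             ≡⟨ twice row rest ⟩
    row + (row + rest)         ≡⟨ cong (λ r → row + (r + rest)) (sum-cong-≗ {n} (λ v → h-sym zero (suc v))) ⟩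
    row + (column + rest)      ≡⟨ cong (row +_) (sym (∑-distrib-+ (λ u → h (suc u) zero) (λ u → ∑[ v < n ] h′ u v))) ⟩
    row + others               ≡⟨ cong (λ d → d + row + others) (sym (h-diag zero)) ⟩
    h zero zero + row + others ∎
  where
  open ≡-Reasoning
  h′ : Fin n → Fin n → ℕ
  h′ u v = h (suc u) (suc v)
  row column rest others : ℕ
  row    = ∑[ v < n ] h zero (suc v)
  column = ∑[ u < n ] h (suc u) zero
  rest   = ∑[ u < n ] ∑[ v < n ] h′ u v
  others = ∑[ u < n ] (h (suc u) zero + ∑[ v < n ] h′ u v)
  twice : ∀ a b → 2 * a + b ≡ a + (a + b)
  twice = solve-∀

sumFin² : ∀ n (h : Fin n → Fin n → ℕ) → sumFin n (λ u → sumFin n (h u)) ≡ ∑[ u < n ] ∑[ v < n ] h u v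
sumFin² n h = trans (sumFin≡sum n _) (sum-cong-≗ {n} (λ u → sumFin≡sum n (h u)))

-- edgeCount and M2 test `u < v` with `⌊_⌋`, which does not compute; `does` does.
ind-∧ : ∀ {A : Set} (a? : Dec A) c → ind (⌊ a? ⌋ ∧ c) ≡ (if does a? then ind c else 0)
ind-∧ (true  because _) c = refl
ind-∧ (false because _) c = refl

if-∧ : ∀ {A : Set} (a? : Dec A) c (x : ℕ) →
       (if ⌊ a? ⌋ ∧ c then x else 0) ≡ (if does a? then (if c then x else 0) else 0)
if-∧ (true  because _) c x = refl
if-∧ (false because _) c x = refl

handshake : (G : Graph) → 2 * edgeCount G ≡ ∑[ u < n G ] deg G u
handshake G = begin
  2 * edgeCount G
    ≡⟨ cong (2 *_) (trans (sumFin² (n G) _) (sum-cong-≗ {n G} λ u → sum-cong-≗ {n G} λ v → ind-∧ (u <? v) (adj G u v))) ⟩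
  2 * upper (n G) (λ u v → ind (adj G u v))
    ≡⟨ double-upper (n G) _ (λ u v → cong ind (adj-sym G u v)) (λ u → cong ind (adj-irrefl G u)) ⟩
  ∑[ u < n G ] ∑[ v < n G ] ind (adj G u v)
    ≡⟨ sum-cong-≗ {n G} (λ u → sym (sumFin≡sum (n G) _)) ⟩
  ∑[ u < n G ] deg G u ∎
  where open ≡-Reasoning

M2-twice : (G : Graph) →
           2 * M2 G ≡ ∑[ u < n G ] ∑[ v < n G ] (if adj G u v then deg G u * deg G v else 0)
M2-twice G = trans
  (cong (2 *_) (trans (sumFin² (n G) _) (sum-cong-≗ {n G} λ u → sum-cong-≗ {n G} λ v → if-∧ (u <? v) (adj G u v) _)))
  (double-upper (n G) _ weight-sym weight-diag)
  where
  weight-sym : ∀ u v → (if adj G u v then deg G u * deg G v else 0) ≡ (if adj G v u then deg G v * deg G u else 0)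
  weight-sym u v rewrite adj-sym G u v | *-comm (deg G u) (deg G v) = refl
  weight-diag : ∀ u → (if adj G u u then deg G u * deg G u else 0) ≡ 0
  weight-diag u rewrite adj-irrefl G u = refl

-- Boolean predicates on Fin n holding at exactly zero or two points.  The cycle
-- condition says this of every row of a cycle's edge relation.

count : ∀ {n} → (Fin n → Bool) → ℕ
count {n} f = ∑[ i < n ] ind (f i)

count-witness : ∀ {n} (f : Fin n → Bool) → count f ≢ 0 → ∃ λ i → T (f i)
count-witness {zero}  f c≢0 = ⊥-elim (c≢0 refl)
count-witness {suc n} f c≢0 with f zero in f0
... | true  = zero , subst T (sym f0) _
... | false = let i , fi = count-witness (f ∘ suc) c≢0 in suc i , fi

count-zero : ∀ {n} (f : Fin n → Bool) → count f ≡ 0 → ∀ i → ¬ T (f i)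
count-zero f c≡0 zero    fi with true ← f zero = case c≡0 of λ ()
count-zero f c≡0 (suc i) fi = count-zero (f ∘ suc) (m+n≡0⇒n≡0 (ind (f zero)) c≡0) i fi

infixl 5 _without_
_without_ : ∀ {n} → (Fin n → Bool) → Fin n → Fin n → Bool
(f without x) w = if does (w ≟ x) then false else f w

without-⊆ : ∀ {n} (f : Fin n → Bool) x w → T ((f without x) w) → w ≢ x × T (f w)
without-⊆ f x w t with w ≟ x
... | yes _   = ⊥-elim t
... | no  w≢x = w≢x , t

count-without : ∀ {n} (f : Fin n → Bool) x → T (f x) → count f ≡ suc (count (f without x))
count-without f zero    fx with true ← f zero = refl
count-without f (suc x) fx =
  trans (cong (ind (f zero) +_) (count-without (f ∘ suc) x fx)) (+-suc (ind (f zero)) _)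

module ZeroOrTwo {n} (f : Fin n → Bool) (zero-or-two : count f ≡ 0 ⊎ count f ≡ 2) where

  one-left : ∀ x → T (f x) → count (f without x) ≡ 1
  one-left x fx = from zero-or-two
    where
    from : count f ≡ 0 ⊎ count f ≡ 2 → count (f without x) ≡ 1
    from (inj₁ c≡0) = case trans (sym (count-without f x fx)) c≡0 of λ ()
    from (inj₂ c≡2) = suc-injective (trans (sym (count-without f x fx)) c≡2)

  partner : ∀ x → T (f x) → ∃ λ y → y ≢ x × T (f y)
  partner x fx =
    let y , fy = count-witness (f without x) (λ c≡0 → case trans (sym (one-left x fx)) c≡0 of λ ())
    in y , without-⊆ f x y fy

  only-two : ∀ x y z → T (f x) → T (f y) → y ≢ x → T (f z) → z ≡ x ⊎ z ≡ y
  only-two x y z fx fy y≢x fz with z ≟ x | z ≟ y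
  ... | yes z≡x | _       = inj₁ z≡x
  ... | no _    | yes z≡y = inj₂ z≡y
  ... | no z≢x  | no z≢y  = ⊥-elim (count-zero (f without x without y) none-left z fz′)
    where
    fy′ : T ((f without x) y)
    fy′ with y ≟ x
    ... | yes y≡x = ⊥-elim (y≢x y≡x)
    ... | no  _   = fy
    none-left : count (f without x without y) ≡ 0
    none-left = suc-injective (trans (sym (count-without (f without x) y fy′)) (one-left x fx))
    fz′ : T ((f without x without y) z)
    fz′ with z ≟ x | z ≟ y
    ... | yes z≡x | _       = ⊥-elim (z≢x z≡x)
    ... | no _    | yes z≡y = ⊥-elim (z≢y z≡y)
    ... | no _    | no _    = fz

/-<-/ : ∀ a b c d .{{_ : NonZero b}} .{{_ : NonZero d}} →
        a * d < c * b → (ℤ.+ a) / b <ℚ (ℤ.+ c) / d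
/-<-/ a (suc b) c (suc d) ad<cb =
  toℚᵘ-cancel-< (ℚᵘ.<-respˡ-≃ (ℚᵘ.≃-sym (toℚᵘ-fromℚᵘ _)) (ℚᵘ.<-respʳ-≃ (ℚᵘ.≃-sym (toℚᵘ-fromℚᵘ _)) unnormalised))
  where
  unnormalised : ℚᵘ.mkℚᵘ (ℤ.+ a) b ℚᵘ.< ℚᵘ.mkℚᵘ (ℤ.+ c) d
  unnormalised = ℚᵘ.*<* (subst₂ ℤ._<_ (ℤ.pos-* a (suc d)) (ℤ.pos-* c (suc b)) (+<+ ad<cb))

reach-trans : ∀ {n} {R : Rel n} {u v w} → Reach R u v → Reach R v w → Reach R u w
reach-trans here        q = q
reach-trans (there e p) q = there e (reach-trans p q)

reach-sym : ∀ {n} {R : Rel n} → (∀ u v → R u v ≡ R v u) → ∀ {u v} → Reach R u v → Reach R v u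
reach-sym R-sym here                  = here
reach-sym R-sym (there {u} {w} e p) =
  reach-trans (reach-sym R-sym p) (there (subst T (R-sym u w) e) here)

edgeSet-ext : ∀ {n} (C D : EdgeSet n) → (∀ u v → toRel C u v ≡ toRel D u v) → C ≡ D
edgeSet-ext C D C≗D = trans (sym (tabulate∘lookup C))
  (trans (tabulate-cong λ u → row u) (tabulate∘lookup D))
  where
  row : ∀ u → Vec.lookup C u ≡ Vec.lookup D u
  row u = trans (sym (tabulate∘lookup _)) (trans (tabulate-cong (C≗D u)) (tabulate∘lookup _))

T-ext : ∀ {a b} → (T a → T b) → (T b → T a) → a ≡ b
T-ext {false} {false} _ _ = refl
T-ext {false} {true}  _ g = ⊥-elim (g _)
T-ext {true}  {false} f _ = ⊥-elim (f _)
T-ext {true}  {true}  _ _ = refl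

order-of size-of M1-of M2-of : ℕ → ℕ
order-of k = 3 + 10 * k
size-of  k = 2 + 11 * k
M1-of    k = 6 + 36 * k + 68 * (k * k)
M2-of    k = 4 + 36 * k + 72 * (k * k)

-- The arithmetic core:  M2 · n < M1 · m  once k ≥ 2.
-- With k = 2 + j the difference is 28j³ + 124j² + 150j + 28.
zagreb-gap : ∀ k → 2 ≤ k → M2-of k * order-of k < M1-of k * size-of k
zagreb-gap (suc (suc j)) (s≤s (s≤s z≤n)) =
  subst (M2-of (2 + j) * order-of (2 + j) <_) (sym (gap j)) (s≤s (m≤m+n _ _))
  where
  gap : ∀ j → let k = 2 + j in
        (6 + 36 * k + 68 * (k * k)) * (2 + 11 * k)
          ≡ suc ((4 + 36 * k + 72 * (k * k)) * (3 + 10 * k) + (27 + 150 * j + 124 * (j * j) + 28 * (j * j * j)))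
  gap = solve-∀

data Vertex (k : ℕ) : Set where
  hub bridge star : Vertex k
  leaf            : Fin (8 * k) → Vertex k
  a b             : Fin k → Vertex k

arc : ∀ {k} → Vertex k → Vertex k → Bool
arc hub    bridge   = true
arc bridge star     = true
arc star   (leaf _) = true
arc hub    (a _)    = true
arc hub    (b _)    = true
arc (a i)  (b j)    = does (i ≟ j)
arc _      _        = false

edge : ∀ {k} → Vertex k → Vertex k → Bool
edge x y = arc x y ∨ arc y x

edge-sym : ∀ {k} (x y : Vertex k) → edge x y ≡ edge y x
edge-sym x y = ∨-comm (arc x y) (arc y x)

edge-irrefl : ∀ {k} (x : Vertex k) → edge x x ≡ false
edge-irrefl hub      = refl
edge-irrefl bridge   = refl
edge-irrefl star     = refl
edge-irrefl (leaf _) = refl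
edge-irrefl (a _)    = refl
edge-irrefl (b _)    = refl

module Construction (k : ℕ) where

  N : ℕ
  N = 3 + (8 * k + (k + k))

  decode-triangle : Fin k ⊎ Fin k → Vertex k
  decode-triangle (inj₁ i) = a i
  decode-triangle (inj₂ i) = b i

  decode-block : Fin (8 * k) ⊎ Fin (k + k) → Vertex k
  decode-block (inj₁ j) = leaf j
  decode-block (inj₂ t) = decode-triangle (splitAt k t)

  decode : Fin N → Vertex k
  decode zero                = hub
  decode (suc zero)          = bridge
  decode (suc (suc zero))    = star
  decode (suc (suc (suc u))) = decode-block (splitAt (8 * k) u)

  encode : Vertex k → Fin N
  encode hub      = zero
  encode bridge   = suc zero
  encode star     = suc (suc zero)
  encode (leaf j) = suc (suc (suc (j ↑ˡ (k + k))))
  encode (a i)    = suc (suc (suc ((8 * k) ↑ʳ (i ↑ˡ k))))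
  encode (b i)    = suc (suc (suc ((8 * k) ↑ʳ (k ↑ʳ i))))

  decode-encode : ∀ x → decode (encode x) ≡ x
  decode-encode hub      = refl
  decode-encode bridge   = refl
  decode-encode star     = refl
  decode-encode (leaf j) rewrite splitAt-↑ˡ (8 * k) j (k + k) = refl
  decode-encode (a i)    rewrite splitAt-↑ʳ (8 * k) (k + k) (i ↑ˡ k) | splitAt-↑ˡ k i k = refl
  decode-encode (b i)    rewrite splitAt-↑ʳ (8 * k) (k + k) (k ↑ʳ i) | splitAt-↑ʳ k k i = refl

  encode-decode : ∀ u → encode (decode u) ≡ u
  encode-decode zero                = refl
  encode-decode (suc zero)          = refl
  encode-decode (suc (suc zero))    = refl
  encode-decode (suc (suc (suc u))) =
    trans (block (splitAt (8 * k) u)) (cong (λ u′ → suc (suc (suc u′))) (join-splitAt (8 * k) (k + k) u))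
    where
    triangle : ∀ t → encode (decode-triangle t) ≡ suc (suc (suc ((8 * k) ↑ʳ join k k t)))
    triangle (inj₁ i) = refl
    triangle (inj₂ i) = refl
    block : ∀ s → encode (decode-block s) ≡ suc (suc (suc (join (8 * k) (k + k) s)))
    block (inj₁ j) = refl
    block (inj₂ t) = trans (triangle (splitAt k t)) (cong (λ t′ → suc (suc (suc ((8 * k) ↑ʳ t′)))) (join-splitAt k k t))

  G : Graph
  G = record
    { n      = N
    ; adj    = λ u v → edge (decode u) (decode v)
    ; sym    = λ u v → edge-sym (decode u) (decode v)
    ; irrefl = λ u → edge-irrefl (decode u)
    }

  ∑V : (Vertex k → ℕ) → ℕ
  ∑V F = F hub + (F bridge + (F star + (∑[ j < 8 * k ] F (leaf j) + (∑[ i < k ] F (a i) + ∑[ i < k ] F (b i)))))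

  ∑V-cong : ∀ {F F′ : Vertex k → ℕ} → (∀ x → F x ≡ F′ x) → ∑V F ≡ ∑V F′
  ∑V-cong F≗F′ = cong₂ _+_ (F≗F′ hub) (cong₂ _+_ (F≗F′ bridge) (cong₂ _+_ (F≗F′ star)
    (cong₂ _+_ (sum-cong-≗ {8 * k} (F≗F′ ∘ leaf)) (cong₂ _+_ (sum-cong-≗ {k} (F≗F′ ∘ a)) (sum-cong-≗ {k} (F≗F′ ∘ b))))))

  sum-decode : ∀ (F : Vertex k → ℕ) → ∑[ u < N ] F (decode u) ≡ ∑V F
  sum-decode F = begin
    ∑[ u < N ] F (decode u)            ≡⟨ cong (λ s → F hub + (F bridge + (F star + s))) split ⟩
    ∑V (F ∘ decode ∘ encode)           ≡⟨ ∑V-cong (cong F ∘ decode-encode) ⟩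
    ∑V F                               ∎
    where
    open ≡-Reasoning
    f : Fin (8 * k + (k + k)) → ℕ
    f u = F (decode (suc (suc (suc u))))
    split : sum f ≡ ∑[ j < 8 * k ] F (decode (encode (leaf j)))
                    + (∑[ i < k ] F (decode (encode (a i))) + ∑[ i < k ] F (decode (encode (b i))))
    split = trans (sum-split (8 * k) (k + k) f) (cong (∑[ j < 8 * k ] f (j ↑ˡ (k + k)) +_) (sum-split k k _))

  ∑V-blocks : ∀ (F : Vertex k → ℕ) {ℓ α β} →
              (∀ j → F (leaf j) ≡ ℓ) → (∀ i → F (a i) ≡ α) → (∀ i → F (b i) ≡ β) →
              ∑V F ≡ F hub + (F bridge + (F star + (8 * k * ℓ + (k * α + k * β))))
  ∑V-blocks F {ℓ} {α} {β} Fℓ Fα Fβ = cong (λ s → F hub + (F bridge + (F star + s)))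
    (cong₂ _+_ (trans (sum-cong-≗ {8 * k} Fℓ) (sum-const (8 * k) ℓ))
               (cong₂ _+_ (trans (sum-cong-≗ {k} Fα) (sum-const k α)) (trans (sum-cong-≗ {k} Fβ) (sum-const k β))))

  no-blocks : ∑[ j < 8 * k ] 0 + (∑[ i < k ] 0 + ∑[ i < k ] 0) ≡ 0
  no-blocks = cong₂ _+_ (sum-zero (8 * k)) (cong₂ _+_ (sum-zero k) (sum-zero k))

  degree : Vertex k → ℕ
  degree hub      = suc (k + k)
  degree bridge   = 2
  degree star     = suc (8 * k)
  degree (leaf _) = 1
  degree (a _)    = 2
  degree (b _)    = 2

  neighbours : ∀ x → ∑V (λ y → ind (edge x y)) ≡ degree x
  neighbours hub = cong suc (cong₂ _+_ (sum-zero (8 * k))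
    (cong₂ _+_ (trans (sum-const k 1) (*-identityʳ k)) (trans (sum-const k 1) (*-identityʳ k))))
  neighbours bridge = cong (2 +_) no-blocks
  neighbours star = cong suc (trans (cong₂ _+_ (trans (sum-const (8 * k) 1) (*-identityʳ (8 * k)))
    (cong₂ _+_ (sum-zero k) (sum-zero k))) (+-identityʳ (8 * k)))
  neighbours (leaf _) = cong suc no-blocks
  neighbours (a i) = cong suc (cong₂ _+_ (sum-zero (8 * k))
    (cong₂ _+_ (sum-zero k) (sum-point i (λ β → ind (β ∨ false)) refl)))
  neighbours (b i) = cong suc (cong₂ _+_ (sum-zero (8 * k))
    (cong₂ _+_ (sum-point′ i ind refl) (sum-zero k)))

  deg-G : ∀ u → deg G u ≡ degree (decode u)
  deg-G u = begin
    deg G u                                      ≡⟨ sumFin≡sum N (λ w → ind (edge (decode u) (decode w))) ⟩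
    ∑[ w < N ] ind (edge (decode u) (decode w))  ≡⟨ sum-decode (λ y → ind (edge (decode u) y)) ⟩
    ∑V (λ y → ind (edge (decode u) y))           ≡⟨ neighbours (decode u) ⟩
    degree (decode u)                            ∎
    where open ≡-Reasoning

  sum-degrees : ∀ (F : ℕ → ℕ) → ∑[ u < N ] F (deg G u) ≡ ∑V (F ∘ degree)
  sum-degrees F = trans (sum-cong-≗ {N} (cong F ∘ deg-G)) (sum-decode (F ∘ degree))

  order : n G ≡ order-of k
  order = cong (3 +_) (poly k)
    where poly : ∀ k → 8 * k + (k + k) ≡ 10 * k
          poly = solve-∀

  size : edgeCount G ≡ size-of k
  size = *-cancelˡ-≡ _ _ 2 (begin
    2 * edgeCount G     ≡⟨ handshake G ⟩
    ∑[ u < N ] deg G u  ≡⟨ sum-degrees id ⟩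
    ∑V degree           ≡⟨ trans (∑V-blocks degree (λ _ → refl) (λ _ → refl) (λ _ → refl)) (poly k) ⟩
    2 * size-of k       ∎)
    where
    open ≡-Reasoning
    poly : ∀ k → suc (k + k) + (2 + (suc (8 * k) + (8 * k * 1 + (k * 2 + k * 2)))) ≡ 2 * (2 + 11 * k)
    poly = solve-∀

  M1-closed : M1 G ≡ M1-of k
  M1-closed = begin
    M1 G                            ≡⟨ sumFin≡sum N (λ u → deg G u * deg G u) ⟩
    ∑[ u < N ] (deg G u * deg G u)  ≡⟨ sum-degrees (λ d → d * d) ⟩
    ∑V (λ x → degree x * degree x)  ≡⟨ trans (∑V-blocks (λ x → degree x * degree x) (λ _ → refl) (λ _ → refl) (λ _ → refl)) (poly k) ⟩
    M1-of k                         ∎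
    where
    open ≡-Reasoning
    poly : ∀ k → suc (k + k) * suc (k + k) + (4 + (suc (8 * k) * suc (8 * k) + (8 * k * 1 + (k * 4 + k * 4))))
                 ≡ 6 + 36 * k + 68 * (k * k)
    poly = solve-∀

  weight : Vertex k → ℕ
  weight hub      = suc (k + k) * 2 + (k * (suc (k + k) * 2) + k * (suc (k + k) * 2))
  weight bridge   = 2 * suc (k + k) + 2 * suc (8 * k)
  weight star     = suc (8 * k) * 2 + 8 * k * (suc (8 * k) * 1)
  weight (leaf _) = 1 * suc (8 * k)
  weight (a _)    = 2 * suc (k + k) + 4
  weight (b _)    = 2 * suc (k + k) + 4

  weighted : ∀ x → ∑V (λ y → if edge x y then degree x * degree y else 0) ≡ weight x
  weighted hub      = cong (suc (k + k) * 2 +_)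
    (cong₂ _+_ (sum-zero (8 * k)) (cong₂ _+_ (sum-const k _) (sum-const k _)))
  weighted bridge   = cong (2 * suc (k + k) +_) (trans (cong (2 * suc (8 * k) +_) no-blocks) (+-identityʳ _))
  weighted star     = cong (suc (8 * k) * 2 +_)
    (trans (cong₂ _+_ (sum-const (8 * k) _) (cong₂ _+_ (sum-zero k) (sum-zero k))) (+-identityʳ _))
  weighted (leaf _) = trans (cong (1 * suc (8 * k) +_) no-blocks) (+-identityʳ _)
  weighted (a i)    = cong (2 * suc (k + k) +_) (cong₂ _+_ (sum-zero (8 * k))
    (cong₂ _+_ (sum-zero k) (sum-point i (λ β → if β ∨ false then 4 else 0) refl)))
  weighted (b i)    = cong (2 * suc (k + k) +_) (cong₂ _+_ (sum-zero (8 * k))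
    (cong₂ _+_ (sum-point′ i (λ β → if β then 4 else 0) refl) (sum-zero k)))

  M2-closed : M2 G ≡ M2-of k
  M2-closed = *-cancelˡ-≡ _ _ 2 (begin
    2 * M2 G                     ≡⟨ M2-twice G ⟩
    ∑[ u < N ] ∑[ v < N ] (if adj G u v then deg G u * deg G v else 0)
                                 ≡⟨ sum-cong-≗ {N} row ⟩
    ∑[ u < N ] weight (decode u) ≡⟨ sum-decode weight ⟩
    ∑V weight                    ≡⟨ trans (∑V-blocks weight (λ _ → refl) (λ _ → refl) (λ _ → refl)) (poly k) ⟩
    2 * M2-of k                  ∎)
    where
    open ≡-Reasoning
    row : ∀ u → ∑[ v < N ] (if adj G u v then deg G u * deg G v else 0) ≡ weight (decode u)
    row u = trans (sum-cong-≗ {N} λ v → cong₂ (λ d d′ → if adj G u v then d * d′ else 0) (deg-G u) (deg-G v))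
      (trans (sum-decode (λ y → if edge (decode u) y then degree (decode u) * degree y else 0)) (weighted (decode u)))
    poly : ∀ k → suc (k + k) * 2 + (k * (suc (k + k) * 2) + k * (suc (k + k) * 2)) + (2 * suc (k + k) + 2 * suc (8 * k)
      + (suc (8 * k) * 2 + 8 * k * (suc (8 * k) * 1) + (8 * k * (1 * suc (8 * k)) + (k * (2 * suc (k + k) + 4) + k * (2 * suc (k + k) + 4)))))
      ≡ 2 * (4 + 36 * k + 72 * (k * k))
    poly = solve-∀

  step : ∀ x y → T (edge x y) → Reach (adj G) (encode x) (encode y)
  step x y e = there (subst₂ (λ x′ y′ → T (edge x′ y′)) (sym (decode-encode x)) (sym (decode-encode y)) e) here

  star-to-hub : Reach (adj G) (encode star) (encode hub)
  star-to-hub = reach-trans (step star bridge _) (step bridge hub _)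

  to-hub : ∀ x → Reach (adj G) (encode x) (encode hub)
  to-hub hub      = here
  to-hub bridge   = step bridge hub _
  to-hub star     = star-to-hub
  to-hub (leaf j) = reach-trans (step (leaf j) star _) star-to-hub
  to-hub (a i)    = step (a i) hub _
  to-hub (b i)    = step (b i) hub _

  connected : Connected G
  connected u v = subst₂ (Reach (adj G)) (encode-decode u) (encode-decode v)
    (reach-trans (to-hub (decode u)) (reach-sym (adj-sym G) (to-hub (decode v))))

  -- The k triangles.  Membership of a j and b j is tested in the orientation
  -- used by `arc`, which keeps the degree computations definitional.
  inTriangle : Fin k → Vertex k → Bool
  inTriangle i hub   = true
  inTriangle i (a j) = does (j ≟ i)
  inTriangle i (b j) = does (i ≟ j)
  inTriangle i _     = false

  inTriangle-cases : ∀ {i} x → T (inTriangle i x) → x ≡ hub ⊎ x ≡ a i ⊎ x ≡ b i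
  inTriangle-cases hub   _ = inj₁ refl
  inTriangle-cases (a j) t = inj₂ (inj₁ (cong a (≟-sound t)))
  inTriangle-cases (b j) t = inj₂ (inj₂ (cong b (sym (≟-sound t))))

  triangle : Fin k → Vertex k → Vertex k → Bool
  triangle i x y = inTriangle i x ∧ (inTriangle i y ∧ edge x y)

  triangle-elim : ∀ i x y → T (triangle i x y) → T (inTriangle i x) × T (inTriangle i y) × T (edge x y)
  triangle-elim i x y t =
    let tx , t′ = Equivalence.to (T-∧ {inTriangle i x}) t in tx , Equivalence.to (T-∧ {inTriangle i y}) t′

  triangle-intro : ∀ i x y → T (inTriangle i x) → T (inTriangle i y) → T (edge x y) → T (triangle i x y)
  triangle-intro i x y tx ty e =
    Equivalence.from (T-∧ {inTriangle i x}) (tx , Equivalence.from (T-∧ {inTriangle i y}) (ty , e))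

  triangle-sym : ∀ i x y → triangle i x y ≡ triangle i y x
  triangle-sym i x y = T-ext (flip x y) (flip y x)
    where
    flip : ∀ x y → T (triangle i x y) → T (triangle i y x)
    flip x y t = let tx , ty , e = triangle-elim i x y t
                 in triangle-intro i y x ty tx (subst T (edge-sym x y) e)

  triangle-degree : ∀ i x → ∑V (λ y → ind (triangle i x y)) ≡ (if inTriangle i x then 2 else 0)
  triangle-degree i hub = cong (0 +_) (cong₂ _+_ (sum-zero (8 * k))
    (cong₂ _+_ (sum-point′ i (λ β → ind (β ∧ true)) refl) (sum-point i (λ β → ind (β ∧ true)) refl)))
  triangle-degree i bridge   = no-blocks
  triangle-degree i star     = no-blocks
  triangle-degree i (leaf _) = no-blocks
  triangle-degree i (a j) with j ≟ i
  ... | no _     = no-blocks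
  ... | yes refl = cong suc (cong₂ _+_ (sum-zero (8 * k))
    (cong₂ _+_ (sum-point′ i (λ β → ind (β ∧ false)) refl) (sum-point i (λ β → ind (β ∧ (β ∨ false))) refl)))
  triangle-degree i (b j) with i ≟ j
  ... | no _     = no-blocks
  ... | yes refl = cong suc (cong₂ _+_ (sum-zero (8 * k))
    (cong₂ _+_ (sum-point′ i (λ β → ind (β ∧ β)) refl) (sum-point i (λ β → ind (β ∧ false)) refl)))

  triangleSet : Fin k → EdgeSet N
  triangleSet i = Vec.tabulate λ u → Vec.tabulate (triangle i (decode u) ∘ decode)

  triangleSet-rel : ∀ i u v → toRel (triangleSet i) u v ≡ triangle i (decode u) (decode v)
  triangleSet-rel i u v =
    trans (cong (λ row → Vec.lookup row v) (lookup∘tabulate (λ u′ → Vec.tabulate (triangle i (decode u′) ∘ decode)) u))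
          (lookup∘tabulate (triangle i (decode u) ∘ decode) v)

  triangleSet-at : ∀ i x y → toRel (triangleSet i) (encode x) (encode y) ≡ triangle i x y
  triangleSet-at i x y = trans (triangleSet-rel i (encode x) (encode y))
    (cong₂ (triangle i) (decode-encode x) (decode-encode y))

  triangleSet-edge : ∀ i x y → T (triangle i x y) → T (toRel (triangleSet i) (encode x) (encode y))
  triangleSet-edge i x y = subst T (sym (triangleSet-at i x y))

  hub-a-in-triangle : ∀ i → T (triangle i hub (a i))
  hub-a-in-triangle i = triangle-intro i hub (a i) _ (≟-complete {i = i} refl) _

  triangle-isCycle : ∀ i → IsCycle G (triangleSet i)
  triangle-isCycle i = ⊆G , symmetric , zero-or-two , (encode hub , encode (a i) , triangleSet-edge i hub (a i) (hub-a-in-triangle i)) , linked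
    where
    R : Rel N
    R = toRel (triangleSet i)

    ⊆G : ∀ u v → T (R u v) → T (adj G u v)
    ⊆G u v t = proj₂ (proj₂ (triangle-elim i (decode u) (decode v) (subst T (triangleSet-rel i u v) t)))

    symmetric : ∀ u v → R u v ≡ R v u
    symmetric u v = trans (triangleSet-rel i u v)
      (trans (triangle-sym i (decode u) (decode v)) (sym (triangleSet-rel i v u)))

    degree-R : ∀ u → degR R u ≡ (if inTriangle i (decode u) then 2 else 0)
    degree-R u = begin
      degR R u                                       ≡⟨ sumFin≡sum N (λ w → ind (R u w)) ⟩
      ∑[ w < N ] ind (R u w)                         ≡⟨ sum-cong-≗ {N} (cong ind ∘ triangleSet-rel i u) ⟩
      ∑[ w < N ] ind (triangle i (decode u) (decode w)) ≡⟨ sum-decode (λ y → ind (triangle i (decode u) y)) ⟩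
      ∑V (λ y → ind (triangle i (decode u) y))       ≡⟨ triangle-degree i (decode u) ⟩
      (if inTriangle i (decode u) then 2 else 0)     ∎
      where open ≡-Reasoning

    zero-or-two : ∀ u → degR R u ≡ 0 ⊎ degR R u ≡ 2
    zero-or-two u with inTriangle i (decode u) | degree-R u
    ... | false | d≡0 = inj₁ d≡0
    ... | true  | d≡2 = inj₂ d≡2

    on-triangle : ∀ u → 0 < degR R u → T (inTriangle i (decode u))
    on-triangle u 0<d with inTriangle i (decode u) | degree-R u
    ... | true  | _   = _
    ... | false | d≡0 = case subst (0 <_) d≡0 0<d of λ ()

    to-hub′ : ∀ x → T (inTriangle i x) → Reach R (encode x) (encode hub)
    to-hub′ x tx with inTriangle-cases x tx
    ... | inj₁ refl        = here
    ... | inj₂ (inj₁ refl) = there (triangleSet-edge i (a i) hub (triangle-intro i (a i) hub tx _ _)) here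
    ... | inj₂ (inj₂ refl) = there (triangleSet-edge i (b i) hub (triangle-intro i (b i) hub tx _ _)) here

    linked : ∀ u v → 0 < degR R u → 0 < degR R v → Reach R u v
    linked u v 0<du 0<dv = subst₂ (Reach R) (encode-decode u) (encode-decode v)
      (reach-trans (to-hub′ (decode u) (on-triangle u 0<du))
                   (reach-sym symmetric (to-hub′ (decode v) (on-triangle v 0<dv))))

  -- Distinct indices give distinct triangles: the edge hub – a i singles out i.
  triangleSet-injective : ∀ i j → triangleSet i ≡ triangleSet j → i ≡ j
  triangleSet-injective i j eq = ≟-sound (proj₁ (proj₂ (triangle-elim j hub (a i)
    (subst T (triangleSet-at j hub (a i))
      (subst (λ C → T (toRel C (encode hub) (encode (a i)))) eq (triangleSet-edge i hub (a i) (hub-a-in-triangle i)))))))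

  encode-injective : ∀ {x y} → encode x ≡ encode y → x ≡ y
  encode-injective {x} {y} eq = trans (sym (decode-encode x)) (trans (cong decode eq) (decode-encode y))

  a-neighbours : ∀ {i : Fin k} {y} → T (edge (a i) y) → y ≡ hub ⊎ y ≡ b i
  a-neighbours {y = hub}   _ = inj₁ refl
  a-neighbours {y = b j}   e = inj₂ (cong b (sym (≟-sound (subst T (∨-identityʳ _) e))))
  a-neighbours {y = bridge} ()
  a-neighbours {y = star}   ()
  a-neighbours {y = leaf _} ()
  a-neighbours {y = a _}    ()

  b-neighbours : ∀ {i : Fin k} {y} → T (edge (b i) y) → y ≡ hub ⊎ y ≡ a i
  b-neighbours {y = hub}   _ = inj₁ refl
  b-neighbours {y = a j}   e = inj₂ (cong a (≟-sound e))
  b-neighbours {y = bridge} ()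
  b-neighbours {y = star}   ()
  b-neighbours {y = leaf _} ()
  b-neighbours {y = b _}    ()

  TriangleIn : (Vertex k → Vertex k → Set) → Fin k → Set
  TriangleIn _─_ i = (a i ─ hub) × (a i ─ b i) × (b i ─ hub)

  module OnCycle (C : EdgeSet N) (C⊆G : ∀ u v → T (toRel C u v) → T (adj G u v))
                 (C-sym : ∀ u v → toRel C u v ≡ toRel C v u)
                 (C-deg : ∀ v → degR (toRel C) v ≡ 0 ⊎ degR (toRel C) v ≡ 2) where

    record _─_ (x y : Vertex k) : Set where
      constructor on-C
      field edge-on-C : T (toRel C (encode x) (encode y))
    open _─_

    on-G : ∀ {x y} → x ─ y → T (edge x y)
    on-G {x} {y} (on-C e) = subst₂ (λ x′ y′ → T (edge x′ y′)) (decode-encode x) (decode-encode y) (C⊆G _ _ e)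

    ─-sym : ∀ {x y} → x ─ y → y ─ x
    ─-sym {x} {y} (on-C e) = on-C (subst T (C-sym (encode x) (encode y)) e)

    row : ∀ x → count (toRel C (encode x)) ≡ 0 ⊎ count (toRel C (encode x)) ≡ 2
    row x = subst (λ d → d ≡ 0 ⊎ d ≡ 2) (sumFin≡sum N (λ w → ind (toRel C (encode x) w))) (C-deg (encode x))

    partner : ∀ {x y} → x ─ y → ∃ λ y′ → y′ ≢ y × x ─ y′
    partner {x} {y} (on-C e) =
      let w , w≢y , xw = ZeroOrTwo.partner (toRel C (encode x)) (row x) (encode y) e
      in decode w , (λ w≡y → w≢y (trans (sym (encode-decode w)) (cong encode w≡y)))
                  , on-C (subst (T ∘ toRel C (encode x)) (sym (encode-decode w)) xw)

    only-two : ∀ {x y₁ y₂ z} → x ─ y₁ → x ─ y₂ → y₂ ≢ y₁ → x ─ z → z ≡ y₁ ⊎ z ≡ y₂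
    only-two {x} {y₁} {y₂} {z} (on-C e₁) (on-C e₂) y₂≢y₁ (on-C e) =
      Sum.map encode-injective encode-injective
        (ZeroOrTwo.only-two (toRel C (encode x)) (row x) (encode y₁) (encode y₂) (encode z) e₁ e₂ (y₂≢y₁ ∘ encode-injective) e)

    isolated : ∀ {x w} → (∀ {y} → x ─ y → y ≡ w) → ∀ {y} → ¬ x ─ y
    isolated only-w e = let _ , y′≢y , e′ = partner e in y′≢y (trans (only-w e′) (sym (only-w e)))

    both : ∀ {x y w₁ w₂} → (∀ {y} → T (edge x y) → y ≡ w₁ ⊎ y ≡ w₂) → x ─ y → x ─ w₁ × x ─ w₂
    both nb e with partner e
    ... | _ , y′≢y , e′ with nb (on-G e) | nb (on-G e′)
    ... | inj₁ refl | inj₂ refl = e , e′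
    ... | inj₂ refl | inj₁ refl = e′ , e
    ... | inj₁ refl | inj₁ refl = ⊥-elim (y′≢y refl)
    ... | inj₂ refl | inj₂ refl = ⊥-elim (y′≢y refl)

    leaf-off : ∀ {j y} → ¬ leaf j ─ y
    leaf-off {j} = isolated (only-star {j})
      where
      only-star : ∀ {j y} → leaf j ─ y → y ≡ star
      only-star {y = star} _ = refl
      only-star {y = hub}    e = ⊥-elim (on-G e)
      only-star {y = bridge} e = ⊥-elim (on-G e)
      only-star {y = leaf _} e = ⊥-elim (on-G e)
      only-star {y = a _}    e = ⊥-elim (on-G e)
      only-star {y = b _}    e = ⊥-elim (on-G e)

    star-off : ∀ {y} → ¬ star ─ y
    star-off = isolated only-bridge
      where
      only-bridge : ∀ {y} → star ─ y → y ≡ bridge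
      only-bridge {bridge} _ = refl
      only-bridge {leaf _} e = ⊥-elim (leaf-off (─-sym e))
      only-bridge {hub}    e = ⊥-elim (on-G e)
      only-bridge {star}   e = ⊥-elim (on-G e)
      only-bridge {a _}    e = ⊥-elim (on-G e)
      only-bridge {b _}    e = ⊥-elim (on-G e)

    bridge-off : ∀ {y} → ¬ bridge ─ y
    bridge-off = isolated only-hub
      where
      only-hub : ∀ {y} → bridge ─ y → y ≡ hub
      only-hub {hub}    _ = refl
      only-hub {star}   e = ⊥-elim (star-off (─-sym e))
      only-hub {bridge} e = ⊥-elim (on-G e)
      only-hub {leaf _} e = ⊥-elim (on-G e)
      only-hub {a _}    e = ⊥-elim (on-G e)
      only-hub {b _}    e = ⊥-elim (on-G e)

    closes-a : ∀ {i y} → a i ─ y → TriangleIn _─_ i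
    closes-a e = let a─hub , a─b = both a-neighbours e
                     b─hub , _   = both b-neighbours (─-sym a─b)
                 in a─hub , a─b , b─hub

    closes-b : ∀ {i y} → b i ─ y → TriangleIn _─_ i
    closes-b e = closes-a (─-sym (proj₂ (both b-neighbours e)))

    some-triangle : ∀ {x y} → x ─ y → ∃ (TriangleIn _─_)
    some-triangle {hub} {a i}    e = i , closes-a (─-sym e)
    some-triangle {hub} {b i}    e = i , closes-b (─-sym e)
    some-triangle {hub} {bridge} e = ⊥-elim (bridge-off (─-sym e))
    some-triangle {hub} {hub}    e = ⊥-elim (on-G e)
    some-triangle {hub} {star}   e = ⊥-elim (on-G e)
    some-triangle {hub} {leaf _} e = ⊥-elim (on-G e)
    some-triangle {bridge}       e = ⊥-elim (bridge-off e)
    some-triangle {star}         e = ⊥-elim (star-off e)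
    some-triangle {leaf _}       e = ⊥-elim (leaf-off e)
    some-triangle {a i}          e = i , closes-a e
    some-triangle {b i}          e = i , closes-b e

    -- Once triangle i lies in C, the hub's two C-edges are used up, so C is that triangle.
    module Containing (i : Fin k) (tri : TriangleIn _─_ i) where

      hub-only : ∀ {z} → hub ─ z → z ≡ a i ⊎ z ≡ b i
      hub-only = only-two (─-sym (proj₁ tri)) (─-sym (proj₂ (proj₂ tri))) (λ ())

      inside : ∀ {x y} → x ─ y → T (inTriangle i x)
      inside {hub}    e = _
      inside {bridge} e = ⊥-elim (bridge-off e)
      inside {star}   e = ⊥-elim (star-off e)
      inside {leaf _} e = ⊥-elim (leaf-off e)
      inside {a j}    e = ≟-complete (a-index (hub-only (─-sym (proj₁ (closes-a e)))))
        where
        a-index : a j ≡ a i ⊎ a j ≡ b i → j ≡ i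
        a-index (inj₁ refl) = refl
      inside {b j}    e = ≟-complete (b-index (hub-only (─-sym (proj₂ (proj₂ (closes-b e))))))
        where
        b-index : b j ≡ a i ⊎ b j ≡ b i → i ≡ j
        b-index (inj₂ refl) = refl

      within : ∀ x y → T (triangle i x y) → x ─ y
      within x y t with triangle-elim i x y t
      ... | tx , ty , e with inTriangle-cases x tx | inTriangle-cases y ty
      ... | inj₁ refl        | inj₁ refl        = ⊥-elim e
      ... | inj₁ refl        | inj₂ (inj₁ refl) = ─-sym (proj₁ tri)
      ... | inj₁ refl        | inj₂ (inj₂ refl) = ─-sym (proj₂ (proj₂ tri))
      ... | inj₂ (inj₁ refl) | inj₁ refl        = proj₁ tri
      ... | inj₂ (inj₁ refl) | inj₂ (inj₁ refl) = ⊥-elim e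
      ... | inj₂ (inj₁ refl) | inj₂ (inj₂ refl) = proj₁ (proj₂ tri)
      ... | inj₂ (inj₂ refl) | inj₁ refl        = proj₂ (proj₂ tri)
      ... | inj₂ (inj₂ refl) | inj₂ (inj₁ refl) = ─-sym (proj₁ (proj₂ tri))
      ... | inj₂ (inj₂ refl) | inj₂ (inj₂ refl) = ⊥-elim e

      C≡triangle : triangleSet i ≡ C
      C≡triangle = edgeSet-ext (triangleSet i) C λ u v → trans (triangleSet-rel i u v) (T-ext
        (λ t → subst₂ (λ u′ v′ → T (toRel C u′ v′)) (encode-decode u) (encode-decode v) (edge-on-C (within _ _ t)))
        (λ t → let e = on-C (subst₂ (λ u′ v′ → T (toRel C u′ v′)) (sym (encode-decode u)) (sym (encode-decode v)) t)
               in triangle-intro i (decode u) (decode v) (inside e) (inside (─-sym e)) (on-G e)))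

  cycle-is-triangle : ∀ C → IsCycle G C → ∃ λ i → triangleSet i ≡ C
  cycle-is-triangle C (C⊆G , C-sym , C-deg , (u₀ , v₀ , e₀) , _) =
    let i , tri = some-triangle {decode u₀} {decode v₀}
                    (on-C (subst₂ (λ u v → T (toRel C u v)) (sym (encode-decode u₀)) (sym (encode-decode v₀)) e₀))
    in i , Containing.C≡triangle i tri
    where open OnCycle C C⊆G C-sym C-deg

  exactly-k-cycles : HasExactlyCycles G k
  exactly-k-cycles = triangles , distinct , λ C → mk⇔
      (λ cyc → let i , eq = cycle-is-triangle C cyc in i , trans (lookup∘tabulate triangleSet i) eq)
      (λ (i , eq) → subst (IsCycle G) (trans (sym (lookup∘tabulate triangleSet i)) eq) (triangle-isCycle i))
    where
    triangles : Vec (EdgeSet N) k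
    triangles = Vec.tabulate triangleSet
    distinct : ∀ i j → Vec.lookup triangles i ≡ Vec.lookup triangles j → i ≡ j
    distinct i j eq = triangleSet-injective i j
      (trans (sym (lookup∘tabulate triangleSet i)) (trans eq (lookup∘tabulate triangleSet j)))

-- `+_` is imported only here: as a prefix operator it would clash with the
-- sections `(x +_)` of addition on ℕ used above.
open import Data.Nat using (_≥_)
open import Data.Integer using (+_)
open import Data.Rational using (_>_)

mainTheorem7 : (k : ℕ) → k ≥ 2 →
    Σ Graph (λ G → Connected G × HasExactlyCycles G k ×
      Σ (NonZero (n G)) (λ nz → Σ (NonZero (edgeCount G)) (λ mz →
        ((+ M1 G) / n G) {{nz}} > ((+ M2 G) / edgeCount G) {{mz}})))
mainTheorem7 k k≥2 = G , connected , exactly-k-cycles , _ , m≢0 , /-<-/ (M2 G) (edgeCount G) (M1 G) (n G) {{m≢0}} gap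
  where
  open Construction k
  m≢0 : NonZero (edgeCount G)
  m≢0 = subst NonZero (sym size) _
  gap : M2 G * n G < M1 G * edgeCount G
  gap = subst₂ _<_ (cong₂ _*_ (sym M2-closed) (sym order)) (cong₂ _*_ (sym M1-closed) (sym size)) (zagreb-gap k k≥2)
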